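{- Let $n\ge10$ and $n-m>m\ge4$. Then $F_{\{2,5,n-m+2\}}$ appears in the expansion of $\mathcal{S}_{(m,n-m)}$ in the basis of fundamental quasisymmetric functions with coefficient at least $2$.
   Context: For $S\subseteq[n-1]$, $F_S=\sum x_{i_1}\cdots x_{i_n}$ over $i_1\le\cdots\le i_n$ with $i_j<i_{j+1}$ whenever $j\in S$. The composition diagram of a composition $\alpha$ has $\alpha_i$ left-justified cells in row $i$ (top to bottom). Cover relation on compositions: $\beta\lessdot\gamma$ if $\gamma=(1)\cdot\beta$ (new top row of one cell, existing rows keeping their cells) or $\gamma$ is obtained from $\beta$ by adding $1$ to the leftmost part of $\beta$ equal to $k$, for some $k$ (cell added at the right end of that row). A standard composition tableau (SCT) of shape $\alpha\vDash n$ comes from a chain $\emptyset=\alpha^{n+1}\lessdot\cdots\lessdot\alpha^1=\alpha$ by putting $i$ in the cell added from $\alpha^{i+1}$ to $\alpha^i$. Its descent set $\mathrm{Des}(T)$ is the set of $i$ with $i+1$ in a column weakly right of the column of $i$. $\mathcal{S}_\alpha=\sum_T F_{\mathrm{Des}(T)}$ over SCT $T$ of shape $\alpha$. -}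

module Defs where

open import Data.Nat using (ℕ; zero; suc; _≤ᵇ_; _≡ᵇ_)
open import Data.Bool using (Bool; true; false; if_then_else_)
open import Data.List using (List; []; _∷_)
open import Data.List.Membership.Propositional using (_∈_)

-- A composition is a list of (positive) parts, read top row first.
Comp : Set
Comp = List ℕ

incLeftmost : ℕ → Comp → Comp
incLeftmost k []       = []
incLeftmost k (a ∷ β)  = if a ≡ᵇ k then suc a ∷ β else a ∷ incLeftmost k β

-- Cover relation β ⋖ γ, indexed also by the column of the added cell.
--  * prepend : γ = (1)·β, the new cell is in column 1;
--  * bump k  : γ is β with its leftmost part equal to k increased by 1,
--              the new cell is at the right end of that row, column k+1.
data Step : Comp → Comp → ℕ → Set where
  prepend : ∀ {β} → Step β (1 ∷ β) 1
  bump    : ∀ {β} (k : ℕ) → k ∈ β → Step β (incLeftmost k β) (suc k)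

-- A standard composition tableau of shape α: a saturated chain
-- ∅ = α^{n+1} ⋖ α^n ⋖ … ⋖ α^1 = α, built upward from ∅.  The step from
-- α^{i+1} to α^i adds the cell containing i (so the last step adds 1).
data SCT : Comp → Set where
  empty : SCT []
  step  : ∀ {β γ c} → SCT β → Step β γ c → SCT γ

-- The chain of shapes α^1, α^2, …, α^{n+1} (determines the tableau).
shapes : ∀ {α} → SCT α → List Comp
shapes {α} empty        = α ∷ []
shapes {α} (step T _)   = α ∷ shapes T

-- columns T = [col(1), col(2), …, col(n)], col(i) = column of entry i.
columns : ∀ {α} → SCT α → List ℕ
columns empty                   = []
columns (step {c = c} T _)      = c ∷ columns T

-- Descent positions of a column word c_1 … c_n, starting at index i:
-- i is a descent iff c_{i+1} ≥ c_i (i+1 weakly right of i). Increasing list.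
descentsFrom : ℕ → List ℕ → List ℕ
descentsFrom i []            = []
descentsFrom i (a ∷ [])      = []
descentsFrom i (a ∷ b ∷ cs)  =
  if a ≤ᵇ b then i ∷ descentsFrom (suc i) (b ∷ cs)
            else descentsFrom (suc i) (b ∷ cs)

Des : ∀ {α} → SCT α → List ℕ
Des T = descentsFrom 1 (columns T)

-- Write m = a + 4 and n − m = m + 1 + d; then n ≥ 10 means a + d ≥ 1.  All tableaux used
-- start the same way: the bottom row begins with the a + 2 largest entries, the top row with
-- the next j + 1, and the bottom row continues with 6, 7, …; entries 5, …, 1 then go in the
-- last columns.  Reading columns of 1, …, n, the tail is three runs of columns each dropping
-- by one, so besides the descent at 2 forced by the placement of 1, …, 5 the only descents
-- are 5 and the last entry of the top-row run, which is n − m + 2.  Placing 5, 4, 3, 2, 1 in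
-- rows (top, bottom, bottom, top, top) with j = a, and (top, top, bottom, top, top) with
-- j = a − 1, gives two such tableaux; for a = 0 the second is replaced by
-- (top, top, bottom, top, bottom) with j = 0, which needs d ≥ 1.  They are different chains
-- because a chain of shapes determines the column of every entry.
module Submission where

open import Defs
open import Data.Nat using (ℕ; zero; suc; _≤_; _<_; _∸_; _+_; _≡ᵇ_; _≤ᵇ_; z≤n; s≤s)
open import Data.Nat.Properties
  using (_≟_; _≤?_; <-irrefl; <-≤-trans; <⇒≤; ≤-refl; ≤-reflexive; ≤-trans; m≤n+m; m≤n⇒m≤o+n; m≤n⇒m≤1+n;
         n≤1+n; n<1+n; m<n⇒m<1+n; <⇒≱; 1+n≢n; +-identityʳ; +-suc; ∸-monoˡ-≤; m≤n⇒∃[o]m+o≡n)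
open import Data.Nat.Tactic.RingSolver using (solve-∀)
open import Data.Bool using (true; false)
open import Data.List using (List; []; _∷_; _++_; length; head; drop)
open import Data.List.Properties using (++-identityʳ; ∷-injectiveˡ; ∷-injectiveʳ)
open import Data.List.Relation.Unary.Any using (here; there; tail)
open import Data.List.Membership.Propositional using (_∈_)
open import Data.Maybe using (just)
open import Data.Maybe.Properties using (just-injective)
open import Data.Product using (Σ; _×_; _,_)
open import Function using (_∘_)
open import Relation.Nullary using (¬_; proof; ofʸ; ofⁿ; contradiction)
open import Relation.Binary.PropositionalEquality
  using (_≡_; _≢_; refl; sym; trans; cong; cong₂; subst; ≢-sym; module ≡-Reasoning)

-- `does (m ≟ n)` computes to `m ≡ᵇ n`, so `proof (m ≟ n)` reflects the test made by incLeftmost.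
incLeftmost-first : ∀ t β → incLeftmost t (t ∷ β) ≡ suc t ∷ β
incLeftmost-first t β with t ≡ᵇ t | proof (t ≟ t)
... | true  | _        = refl
... | false | ofⁿ t≢t = contradiction refl t≢t

incLeftmost-second : ∀ {t y} β → t < y → incLeftmost y (t ∷ y ∷ β) ≡ t ∷ suc y ∷ β
incLeftmost-second {t} {y} β t<y with t ≡ᵇ y | proof (t ≟ y)
... | false | _        = cong (t ∷_) (incLeftmost-first y β)
... | true  | ofʸ refl = contradiction t<y (<-irrefl refl)

grow-first : ∀ {t β} → Step (t ∷ β) (suc t ∷ β) (suc t)
grow-first {t} {β} = subst (λ γ → Step (t ∷ β) γ (suc t)) (incLeftmost-first t β) (bump t (here refl))

grow-second : ∀ {t y β} → t < y → Step (t ∷ y ∷ β) (t ∷ suc y ∷ β) (suc y)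
grow-second {t} {y} {β} t<y =
  subst (λ γ → Step (t ∷ y ∷ β) γ (suc y)) (incLeftmost-second β t<y) (bump y (there (here refl)))

infixl 5 _▷_
_▷_ : ∀ {β γ c} → SCT β → Step β γ c → SCT γ
_▷_ = step

length-incLeftmost : ∀ k β → length (incLeftmost k β) ≡ length β
length-incLeftmost k []      = refl
length-incLeftmost k (a ∷ β) with a ≡ᵇ k
... | true  = refl
... | false = cong suc (length-incLeftmost k β)

incLeftmost-injective : ∀ {k l β} → k ∈ β → l ∈ β → incLeftmost k β ≡ incLeftmost l β → k ≡ l
incLeftmost-injective {k} {l} {a ∷ β} k∈ l∈ eq with a ≡ᵇ k | proof (a ≟ k) | a ≡ᵇ l | proof (a ≟ l)
... | true  | ofʸ refl | true  | ofʸ refl = refl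
... | true  | ofʸ refl | false | _        = contradiction (∷-injectiveˡ eq) 1+n≢n
... | false | _        | true  | ofʸ refl = contradiction (sym (∷-injectiveˡ eq)) 1+n≢n
... | false | ofⁿ a≢k  | false | ofⁿ a≢l  =
  incLeftmost-injective (tail (≢-sym a≢k) k∈) (tail (≢-sym a≢l) l∈) (∷-injectiveʳ eq)

Step-column-unique : ∀ {β γ γ′ c c′} → Step β γ c → Step β γ′ c′ → γ ≡ γ′ → c ≡ c′
Step-column-unique prepend        prepend        _  = refl
Step-column-unique {β} prepend    (bump k _)     eq =
  contradiction (trans (cong length eq) (length-incLeftmost k β)) 1+n≢n
Step-column-unique {β} (bump k _) prepend        eq =
  contradiction (trans (cong length (sym eq)) (length-incLeftmost k β)) 1+n≢n
Step-column-unique (bump k k∈)    (bump l l∈)    eq = cong suc (incLeftmost-injective k∈ l∈ eq)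

head-shapes : ∀ {α} (T : SCT α) → head (shapes T) ≡ just α
head-shapes empty      = refl
head-shapes (step _ _) = refl

shapes≡⇒index≡ : ∀ {α α′} (T : SCT α) (T′ : SCT α′) → shapes T ≡ shapes T′ → α ≡ α′
shapes≡⇒index≡ T T′ eq =
  just-injective (trans (sym (head-shapes T)) (trans (cong head eq) (head-shapes T′)))

shapes≡⇒columns≡ : ∀ {α α′} (T : SCT α) (T′ : SCT α′) → shapes T ≡ shapes T′ → columns T ≡ columns T′
shapes≡⇒columns≡ empty      empty        _  = refl
shapes≡⇒columns≡ empty      (step T′ _)  eq =
  contradiction (trans (cong head (∷-injectiveʳ eq)) (head-shapes T′)) λ ()
shapes≡⇒columns≡ (step T _) empty        eq =
  contradiction (trans (cong head (sym (∷-injectiveʳ eq))) (head-shapes T)) λ ()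
shapes≡⇒columns≡ (step T s) (step T′ s′) eq
  with refl ← shapes≡⇒index≡ T T′ (∷-injectiveʳ eq)
  = cong₂ _∷_ (Step-column-unique s s′ (∷-injectiveˡ eq)) (shapes≡⇒columns≡ T T′ (∷-injectiveʳ eq))

run : ℕ → ℕ → List ℕ
run b zero    = []
run b (suc k) = suc (k + b) ∷ run b k

addRow : ∀ {β} j → SCT β → SCT (suc j ∷ β)
addRow zero    T = T ▷ prepend
addRow (suc j) T = addRow j T ▷ grow-first

columns-addRow : ∀ {β} j (T : SCT β) → columns (addRow j T) ≡ run 0 (suc j) ++ columns T
columns-addRow zero    T = refl
columns-addRow (suc j) T = cong₂ _∷_ (cong (suc ∘ suc) (sym (+-identityʳ j))) (columns-addRow j T)

lengthenSecond : ∀ {t y β} k → t < y → SCT (t ∷ y ∷ β) → SCT (t ∷ k + y ∷ β)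
lengthenSecond         zero    t<y T = T
lengthenSecond {y = y} (suc k) t<y T = lengthenSecond k t<y T ▷ grow-second (<-≤-trans t<y (m≤n+m y k))

columns-lengthenSecond : ∀ {t y β} k (t<y : t < y) (T : SCT (t ∷ y ∷ β)) →
  columns (lengthenSecond k t<y T) ≡ run y k ++ columns T
columns-lengthenSecond zero    t<y T = refl
columns-lengthenSecond (suc k) t<y T = cong (_ ∷_) (columns-lengthenSecond k t<y T)

twoRow : ∀ a j k → j ≤ a → SCT (suc j ∷ k + suc (suc a) ∷ [])
twoRow a j k j≤a = lengthenSecond k (s≤s (s≤s j≤a)) (addRow j (addRow (suc a) empty))

columns-twoRow : ∀ a j k (j≤a : j ≤ a) →
  columns (twoRow a j k j≤a) ≡ run (suc (suc a)) k ++ run 0 (suc j) ++ run 0 (suc (suc a))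
columns-twoRow a j k j≤a = begin
  columns (twoRow a j k j≤a)
    ≡⟨ columns-lengthenSecond k _ _ ⟩
  run (suc (suc a)) k ++ columns (addRow j (addRow (suc a) empty))
    ≡⟨ cong (run (suc (suc a)) k ++_) (columns-addRow j _) ⟩
  run (suc (suc a)) k ++ run 0 (suc j) ++ columns (addRow (suc a) empty)
    ≡⟨ cong (λ cs → run (suc (suc a)) k ++ run 0 (suc j) ++ cs)
            (trans (columns-addRow (suc a) empty) (++-identityʳ _)) ⟩
  run (suc (suc a)) k ++ run 0 (suc j) ++ run 0 (suc (suc a)) ∎
  where open ≡-Reasoning

descentsFrom-≤ : ∀ {x y} i cs → x ≤ y → descentsFrom i (x ∷ y ∷ cs) ≡ i ∷ descentsFrom (suc i) (y ∷ cs)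
descentsFrom-≤ {x} {y} i cs x≤y with x ≤ᵇ y | proof (x ≤? y)
... | true  | _        = refl
... | false | ofⁿ x≰y = contradiction x≤y x≰y

descentsFrom-> : ∀ {x y} i cs → y < x → descentsFrom i (x ∷ y ∷ cs) ≡ descentsFrom (suc i) (y ∷ cs)
descentsFrom-> {x} {y} i cs y<x with x ≤ᵇ y | proof (x ≤? y)
... | false | _        = refl
... | true  | ofʸ x≤y = contradiction x≤y (<⇒≱ y<x)

descentsFrom-run : ∀ b k i ys → descentsFrom i (run b (suc k) ++ ys) ≡ descentsFrom (i + k) (suc b ∷ ys)
descentsFrom-run b zero    i ys = cong (λ p → descentsFrom p (suc b ∷ ys)) (sym (+-identityʳ i))
descentsFrom-run b (suc k) i ys = begin
  descentsFrom i (run b (suc (suc k)) ++ ys)  ≡⟨ descentsFrom-> i (run b k ++ ys) (n<1+n _) ⟩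
  descentsFrom (suc i) (run b (suc k) ++ ys)  ≡⟨ descentsFrom-run b k (suc i) ys ⟩
  descentsFrom (suc i + k) (suc b ∷ ys)       ≡⟨ cong (λ p → descentsFrom p (suc b ∷ ys)) (sym (+-suc i k)) ⟩
  descentsFrom (i + suc k) (suc b ∷ ys)       ∎
  where open ≡-Reasoning

descentsFrom-three-runs : ∀ {c b} i k j → c ≤ suc (k + b) → j < b →
  descentsFrom i (c ∷ run b (suc k) ++ run 0 (suc j) ++ run 0 b) ≡ i ∷ 2 + i + k + j ∷ []
descentsFrom-three-runs {c} {suc b} i k j c≤ (s≤s j≤b) = begin
  descentsFrom i (c ∷ run (suc b) (suc k) ++ run 0 (suc j) ++ R)
    ≡⟨ descentsFrom-≤ i (run (suc b) k ++ run 0 (suc j) ++ R) c≤ ⟩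
  i ∷ descentsFrom (suc i) (run (suc b) (suc k) ++ run 0 (suc j) ++ R)
    ≡⟨ cong (i ∷_) (descentsFrom-run (suc b) k (suc i) (run 0 (suc j) ++ R)) ⟩
  i ∷ descentsFrom (suc i + k) (suc (suc b) ∷ run 0 (suc j) ++ R)
    ≡⟨ cong (i ∷_) (descentsFrom-> (suc i + k) (run 0 j ++ R) (s≤s (s≤s j+0≤b))) ⟩
  i ∷ descentsFrom (2 + i + k) (run 0 (suc j) ++ R)
    ≡⟨ cong (i ∷_) (descentsFrom-run 0 j (2 + i + k) R) ⟩
  i ∷ descentsFrom (2 + i + k + j) (1 ∷ R)
    ≡⟨ cong (i ∷_) (descentsFrom-≤ (2 + i + k + j) (run 0 b) (s≤s z≤n)) ⟩
  i ∷ 2 + i + k + j ∷ descentsFrom (3 + i + k + j) R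
    ≡⟨ cong (λ ds → i ∷ 2 + i + k + j ∷ ds)
            (trans (cong (descentsFrom _) (sym (++-identityʳ R))) (descentsFrom-run 0 b _ [])) ⟩
  i ∷ 2 + i + k + j ∷ [] ∎
  where
  open ≡-Reasoning
  R = run 0 (suc b)
  j+0≤b : j + 0 ≤ b
  j+0≤b = ≤-trans (≤-reflexive (+-identityʳ j)) j≤b

descentsFrom-prefix : ∀ {c₁ c₂ c₃ c₄ c₅} cs → c₂ < c₁ → c₂ ≤ c₃ → c₄ < c₃ → c₅ < c₄ →
  descentsFrom 1 (c₁ ∷ c₂ ∷ c₃ ∷ c₄ ∷ c₅ ∷ cs) ≡ 2 ∷ descentsFrom 5 (c₅ ∷ cs)
descentsFrom-prefix {c₁} {c₂} {c₃} {c₄} {c₅} cs c₂<c₁ c₂≤c₃ c₄<c₃ c₅<c₄ = begin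
  descentsFrom 1 (c₁ ∷ c₂ ∷ c₃ ∷ c₄ ∷ c₅ ∷ cs)  ≡⟨ descentsFrom-> 1 (c₃ ∷ c₄ ∷ c₅ ∷ cs) c₂<c₁ ⟩
  descentsFrom 2 (c₂ ∷ c₃ ∷ c₄ ∷ c₅ ∷ cs)       ≡⟨ descentsFrom-≤ 2 (c₄ ∷ c₅ ∷ cs) c₂≤c₃ ⟩
  2 ∷ descentsFrom 3 (c₃ ∷ c₄ ∷ c₅ ∷ cs)        ≡⟨ cong (2 ∷_) (descentsFrom-> 3 (c₅ ∷ cs) c₄<c₃) ⟩
  2 ∷ descentsFrom 4 (c₄ ∷ c₅ ∷ cs)             ≡⟨ cong (2 ∷_) (descentsFrom-> 4 cs c₅<c₄) ⟩
  2 ∷ descentsFrom 5 (c₅ ∷ cs)                  ∎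
  where open ≡-Reasoning

descentsFrom-twoRow : ∀ {c₁ c₂ c₃ c₄ c₅} a j k (j≤a : j ≤ a) →
  c₂ < c₁ → c₂ ≤ c₃ → c₄ < c₃ → c₅ < c₄ → c₅ ≤ suc (k + suc (suc a)) →
  descentsFrom 1 (c₁ ∷ c₂ ∷ c₃ ∷ c₄ ∷ c₅ ∷ columns (twoRow a j (suc k) j≤a)) ≡ 2 ∷ 5 ∷ 7 + k + j ∷ []
descentsFrom-twoRow {c₁} {c₂} {c₃} {c₄} {c₅} a j k j≤a c₂<c₁ c₂≤c₃ c₄<c₃ c₅<c₄ c₅≤ = begin
  descentsFrom 1 (c₁ ∷ c₂ ∷ c₃ ∷ c₄ ∷ c₅ ∷ columns (twoRow a j (suc k) j≤a))
    ≡⟨ descentsFrom-prefix (columns (twoRow a j (suc k) j≤a)) c₂<c₁ c₂≤c₃ c₄<c₃ c₅<c₄ ⟩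
  2 ∷ descentsFrom 5 (c₅ ∷ columns (twoRow a j (suc k) j≤a))
    ≡⟨ cong (λ cs → 2 ∷ descentsFrom 5 (c₅ ∷ cs)) (columns-twoRow a j (suc k) j≤a) ⟩
  2 ∷ descentsFrom 5 (c₅ ∷ run (suc (suc a)) (suc k) ++ run 0 (suc j) ++ run 0 (suc (suc a)))
    ≡⟨ cong (2 ∷_) (descentsFrom-three-runs 5 k j c₅≤ (s≤s (m≤n⇒m≤1+n j≤a))) ⟩
  2 ∷ 5 ∷ 7 + k + j ∷ [] ∎
  where open ≡-Reasoning

descent-position : ∀ d a → 7 + d + a ≡ 3 + (d + (2 + a)) + 2
descent-position = solve-∀

module _ (a d : ℕ) where
  private
    a≤d+2+a : a ≤ d + (2 + a)
    a≤d+2+a = m≤n⇒m≤o+n d (m≤n+m a 2)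
    2+a<1+d+2+a : 2 + a < suc (d + (2 + a))
    2+a<1+d+2+a = s≤s (m≤n+m (2 + a) d)
    2+a<2+d+2+a : 2 + a < 2 + (d + (2 + a))
    2+a<2+d+2+a = m<n⇒m<1+n 2+a<1+d+2+a

  tableauX : SCT (4 + a ∷ 3 + (d + (2 + a)) ∷ [])
  tableauX = twoRow a a (suc d) ≤-refl
    ▷ grow-first ▷ grow-second 2+a<1+d+2+a ▷ grow-second 2+a<2+d+2+a ▷ grow-first ▷ grow-first

  Des-tableauX : Des tableauX ≡ 2 ∷ 5 ∷ 3 + (d + (2 + a)) + 2 ∷ []
  Des-tableauX =
    trans (descentsFrom-twoRow a a d ≤-refl ≤-refl (s≤s (s≤s (s≤s a≤d+2+a))) ≤-refl 2+a<2+d+2+a (<⇒≤ 2+a<1+d+2+a))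
          (cong (λ p → 2 ∷ 5 ∷ p ∷ []) (descent-position d a))

module _ (a d : ℕ) where
  private
    4+a≤2+d+3+a : 4 + a ≤ 2 + (d + (3 + a))
    4+a≤2+d+3+a = s≤s (s≤s (m≤n⇒m≤o+n d (n≤1+n (2 + a))))

  tableauY : SCT (4 + suc a ∷ 3 + (d + (2 + suc a)) ∷ [])
  tableauY = twoRow (suc a) a (suc (suc d)) (n≤1+n a)
    ▷ grow-first ▷ grow-first ▷ grow-second 4+a≤2+d+3+a ▷ grow-first ▷ grow-first

  Des-tableauY : Des tableauY ≡ 2 ∷ 5 ∷ 3 + (d + (2 + suc a)) + 2 ∷ []
  Des-tableauY =
    trans (descentsFrom-twoRow (suc a) a (suc d) (n≤1+n a)
             ≤-refl (m≤n⇒m≤1+n 4+a≤2+d+3+a) (m≤n⇒m≤1+n 4+a≤2+d+3+a) ≤-refl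
             (≤-trans (n≤1+n _) (<⇒≤ 4+a≤2+d+3+a)))
          (cong (λ p → 2 ∷ 5 ∷ p ∷ []) (trans (cong (7 +_) (sym (+-suc d a))) (descent-position d (suc a))))

module _ (e : ℕ) where
  private
    4≤2+e+2 : 4 ≤ 2 + (e + 2)
    4≤2+e+2 = s≤s (s≤s (m≤n+m 2 e))

  tableauZ : SCT (4 ∷ 3 + (suc e + 2) ∷ [])
  tableauZ = twoRow 0 0 (suc (suc e)) z≤n
    ▷ grow-first ▷ grow-first ▷ grow-second 4≤2+e+2 ▷ grow-first ▷ grow-second (s≤s 4≤2+e+2)

  Des-tableauZ : Des tableauZ ≡ 2 ∷ 5 ∷ 3 + (suc e + 2) + 2 ∷ []
  Des-tableauZ =
    trans (descentsFrom-twoRow 0 0 (suc e) z≤n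
             (m≤n⇒m≤1+n (s≤s 4≤2+e+2)) (m≤n⇒m≤1+n 4≤2+e+2) (m≤n⇒m≤1+n 4≤2+e+2) ≤-refl (s≤s (s≤s z≤n)))
          (cong (λ p → 2 ∷ 5 ∷ p ∷ []) (descent-position (suc e) 0))

TwoTableaux : ℕ → ℕ → Set
TwoTableaux m p = Σ (SCT (m ∷ p ∷ [])) λ T₁ → Σ (SCT (m ∷ p ∷ [])) λ T₂ →
  shapes T₁ ≢ shapes T₂ × Des T₁ ≡ 2 ∷ 5 ∷ (p + 2) ∷ [] × Des T₂ ≡ 2 ∷ 5 ∷ (p + 2) ∷ []

twoTableaux : ∀ a d → ¬ (a ≡ 0 × d ≡ 0) → TwoTableaux (4 + a) (3 + (d + (2 + a)))
twoTableaux zero zero ¬a≡0×d≡0 = contradiction (refl , refl) ¬a≡0×d≡0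
twoTableaux zero (suc e) _ =
  tableauX 0 (suc e) , tableauZ e , X≢Z , Des-tableauX 0 (suc e) , Des-tableauZ e
  where
  X≢Z : shapes (tableauX 0 (suc e)) ≢ shapes (tableauZ e)
  X≢Z eq = contradiction (∷-injectiveˡ (cong (drop 1) (shapes≡⇒columns≡ (tableauX 0 (suc e)) (tableauZ e) eq))) λ ()
twoTableaux (suc a) d _ =
  tableauX (suc a) d , tableauY a d , X≢Y , Des-tableauX (suc a) d , Des-tableauY a d
  where
  X≢Y : shapes (tableauX (suc a) d) ≢ shapes (tableauY a d)
  X≢Y eq = contradiction (∷-injectiveˡ (cong (drop 4) (shapes≡⇒columns≡ (tableauX (suc a) d) (tableauY a d) eq))) 1+n≢n

bottom-length : ∀ a d → 3 + (d + (2 + a)) ≡ 5 + a + d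
bottom-length = solve-∀

lemma5p5 : (n m : ℕ) → 10 ≤ n → 4 ≤ m → m < n ∸ m →
    Σ (SCT (m ∷ (n ∸ m) ∷ [])) λ T₁ → Σ (SCT (m ∷ (n ∸ m) ∷ [])) λ T₂ →
      shapes T₁ ≢ shapes T₂
      × Des T₁ ≡ 2 ∷ 5 ∷ (n ∸ m + 2) ∷ []
      × Des T₂ ≡ 2 ∷ 5 ∷ (n ∸ m + 2) ∷ []
lemma5p5 n (suc (suc (suc (suc a)))) 10≤n (s≤s (s≤s (s≤s (s≤s z≤n)))) m<n∸m
  with d , m+1+d≡n∸m ← m≤n⇒∃[o]m+o≡n m<n∸m
  = subst (TwoTableaux (4 + a)) (trans (bottom-length a d) m+1+d≡n∸m) (twoTableaux a d ¬a≡0×d≡0)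
  where
  ¬a≡0×d≡0 : ¬ (a ≡ 0 × d ≡ 0)
  ¬a≡0×d≡0 (refl , refl) = <-irrefl refl (subst (6 ≤_) (sym m+1+d≡n∸m) (∸-monoˡ-≤ 4 10≤n))
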